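{- Let $S\subset\mathbb N$ and let $a,b,c,d$ be positive integers with $\gcd(a,b)=1$, $a\le c$, $b\le d$, such that $d$, $a+d$, $c$, $b+c$ all lie in $S$ (in particular this applies when $a$, $b$, $a+b\in S$ with $\gcd(a,b)=1$). Then all positive integers less than $a+b$ lie in the same connected component of $G(S)$. Moreover, if $S$ contains infinitely many such subsets $\{d,a+d,c,b+c\}$, then $G(S)$ is connected, and therefore $S$ is uniquely avoidable if it is avoidable at all.
   Context: For $S\subset\mathbb N$, the graph $G(S)$ has vertex set $\mathbb N$ (positive integers) with an edge between $x$ and $y$ whenever $x\ne y$ and $x+y\in S$. A partition of $\mathbb N$ into two sets avoids $S$ if no two distinct elements of the same part have sum in $S$; $S$ is avoidable if such a partition exists, and uniquely avoidable if exactly one such partition (unordered) exists. -}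

module Defs where

open import Data.Nat using (ℕ; zero; suc; _+_; _≤_; _<_)
open import Data.Nat.GCD using (gcd)
open import Data.Bool using (Bool; not)
open import Data.Product using (_×_; ∃; Σ)
open import Data.Sum using (_⊎_)
open import Relation.Nullary using (¬_)
open import Relation.Binary.PropositionalEquality using (_≡_; _≢_)
open import Relation.Binary.Construct.Closure.ReflexiveTransitive using (Star)

Subset : Set₁
Subset = ℕ → Set

Edge : Subset → ℕ → ℕ → Set
Edge S x y = (0 < x) × (0 < y) × (x ≢ y) × S (x + y)

SameComponent : Subset → ℕ → ℕ → Set
SameComponent S x y = Star (Edge S) x y

Connected : Subset → Set
Connected S = ∀ x y → 0 < x → 0 < y → SameComponent S x y

-- A two-part partition of the positive integers, encoded by a colouring
-- (the part of x is the Bool value; only positive x matter).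
Colouring : Set
Colouring = ℕ → Bool

Avoids : Subset → Colouring → Set
Avoids S f = ∀ x y → 0 < x → 0 < y → x ≢ y → f x ≡ f y → ¬ S (x + y)

Avoidable : Subset → Set
Avoidable S = ∃ λ f → Avoids S f

SamePartition : Colouring → Colouring → Set
SamePartition f g = (∀ x → 0 < x → f x ≡ g x) ⊎ (∀ x → 0 < x → f x ≡ not (g x))

UniquelyAvoidable : Subset → Set
UniquelyAvoidable S =
  Avoidable S × (∀ f g → Avoids S f → Avoids S g → SamePartition f g)

Config : Subset → ℕ → ℕ → ℕ → ℕ → Set
Config S a b c d =
  (0 < a) × (0 < b) × (0 < c) × (0 < d) ×
  (gcd a b ≡ 1) × (a ≤ c) × (b ≤ d) ×
  S d × S (a + d) × S c × S (b + c)

-- S contains infinitely many subsets {d, a+d, c, b+c} arising from configurations: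
-- a family of finite subsets of ℕ is infinite iff their elements are unbounded.
InfinitelyManyConfigs : Subset → Set
InfinitelyManyConfigs S =
  ∀ N → Σ ℕ λ a → Σ ℕ λ b → Σ ℕ λ c → Σ ℕ λ d →
    Config S a b c d × (N < d ⊎ N < a + d ⊎ N < c ⊎ N < b + c)

{-# OPTIONS --safe #-}
-- If d and a + d lie in S then, for 0 < x < d, the walk
-- x — (d − x) — (x + a) joins x to x + a in G(S) (an edge collapses when its ends
-- coincide).  So the component relation is closed under the shifts x ↦ x + a for
-- x < b and x ↦ x + b for x < a.  For coprime a < b these shifts contain the ones
-- for the pair (a, b − a), and a Euclidean descent down to (1, 1) links all of
-- 1, …, a + b − 1.  Iterating the shift by a then links everything below a + d, so
-- unboundedly many configurations make G(S) connected; along an edge an avoiding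
-- colouring changes colour, so on a connected graph it is fixed by the colour of 1.
module Submission where

open import Defs
open import Data.Nat using (ℕ; _+_; _<_)
open import Data.Nat.GCD using (gcd)
open import Data.Product using (_×_)
open import Relation.Binary.PropositionalEquality using (_≡_)

open import Level using (Level)
open import Data.Nat using (suc; _∸_; _≤_; z<s; s<s; _≟_; _<?_)
open import Data.Nat.Properties
open import Data.Nat.Induction using (<-wellFounded)
open import Data.Nat.GCD using (gcd-comm)
open import Data.Nat.Coprimality as Coprimality using (Coprime; gcd≡1⇒coprime)
open import Data.Nat.Divisibility using (∣-refl; ∣m∣n⇒∣m+n)
open import Data.Bool as Bool using (not)
open import Data.Bool.Properties using (not-injective; ¬-not)
open import Data.Product using (∃; _,_)
open import Data.Sum using (inj₁; inj₂)
open import Function using (_∘_)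
open import Induction.WellFounded using (Acc; acc)
open import Relation.Binary using (Rel; IsEquivalence; tri<; tri≈; tri>)
open import Relation.Binary.PropositionalEquality
  using (refl; sym; trans; cong; subst; module ≡-Reasoning)
open import Relation.Binary.Construct.Closure.ReflexiveTransitive
  using (ε; _◅_; _◅◅_; reverse)
open import Relation.Nullary using (yes; no)

positive-difference : ∀ {a b} → a < b → ∃ λ k → 0 < k × a + k ≡ b
positive-difference {a} a<b with m≤n⇒∃[o]m+o≡n a<b
... | k , 1+a+k≡b = suc k , z<s , trans (+-suc a k) 1+a+k≡b

coprime-reduce : ∀ {a b} → Coprime a (a + b) → Coprime a b
coprime-reduce coprime (i∣a , i∣b) = coprime (i∣a , ∣m∣n⇒∣m+n i∣a i∣b)

coprime-diagonal : ∀ {a} → Coprime a a → a ≡ 1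
coprime-diagonal coprime = coprime (∣-refl , ∣-refl)

module Shifts {ℓ : Level} {R : Rel ℕ ℓ} (isEquivalence : IsEquivalence R) where

  open IsEquivalence isEquivalence
    using () renaming (refl to R-refl; sym to R-sym; trans to R-trans)

  Shift : ℕ → ℕ → Set ℓ
  Shift a n = ∀ x → 0 < x → x < n → R x (x + a)

  Linked : ℕ → Set ℓ
  Linked n = ∀ x → 0 < x → x < n → R 1 x

  Linked⇒related : ∀ {n x y} → Linked n →
                   0 < x → x < n → 0 < y → y < n → R x y
  Linked⇒related linked 0<x x<n 0<y y<n =
    R-trans (R-sym (linked _ 0<x x<n)) (linked _ 0<y y<n)

  Linked-2 : Linked 2
  Linked-2 1 _ _ = R-refl
  Linked-2 (suc (suc _)) _ (s<s (s<s ()))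

  Shift-restrict : ∀ {a m n} → n ≤ m → Shift a m → Shift a n
  Shift-restrict n≤m shift x 0<x x<n = shift x 0<x (<-≤-trans x<n n≤m)

  -- x ~ x + (a + b) ~ x + b + a, the second step being a shift by a of x + b < a + b.
  Shift-reduce : ∀ {a b} → Shift a (a + b) → Shift (a + b) a → Shift b a
  Shift-reduce {a} {b} shiftA shiftAB x 0<x x<a = R-trans (shiftAB x 0<x x<a) x+b+a~x+b
    where
    x+b+a~x+b : R (x + (a + b)) (x + b)
    x+b+a~x+b = R-sym (subst (R (x + b)) (trans (+-assoc x b a) (cong (x +_) (+-comm b a)))
                  (shiftA (x + b) (<-≤-trans 0<x (m≤m+n x b)) (+-monoˡ-< b x<a)))

  Linked-extend : ∀ {a n m} → 0 < a → a < n → Linked n → Shift a m → Linked (a + m)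
  Linked-extend {a} {n} {m} 0<a a<n linked shift x = go x (<-wellFounded x)
    where
    go : ∀ x → Acc _<_ x → 0 < x → x < a + m → R 1 x
    go x (acc rec) 0<x x<a+m with x <? n
    ... | yes x<n = linked x 0<x x<n
    ... | no x≮n with positive-difference (<-≤-trans a<n (≮⇒≥ x≮n))
    ...   | y , 0<y , refl =
      R-trans (go y (rec (m<n+m y 0<a)) 0<y (<-≤-trans y<m (m≤n+m m a)))
            (subst (R y) (+-comm y a) (shift y 0<y y<m))
      where
      y<m : y < m
      y<m = +-cancelˡ-< a y m x<a+m

  Coprime⇒Linked : ∀ {a b} → 0 < a → 0 < b → Coprime a b →
                   Shift a b → Shift b a → Linked (a + b)
  Coprime⇒Linked {a} {b} = go a b (<-wellFounded (a + b))
    where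
    go : ∀ a b → Acc _<_ (a + b) → 0 < a → 0 < b → Coprime a b →
         Shift a b → Shift b a → Linked (a + b)
    go a b (acc rec) 0<a 0<b coprime shiftA shiftB with <-cmp a b
    ... | tri≈ _ refl _ rewrite coprime-diagonal coprime = Linked-2
    ... | tri< a<b _ _ with positive-difference a<b
    ...   | b′ , 0<b′ , refl =
      Linked-extend 0<a (m<m+n a 0<b′)
        (go a b′ (rec (m<n+m (a + b′) 0<a)) 0<a 0<b′ (coprime-reduce coprime)
            (Shift-restrict (m≤n+m b′ a) shiftA) (Shift-reduce shiftA shiftB))
        shiftA
    go a b (acc rec) 0<a 0<b coprime shiftA shiftB | tri> _ _ b<a
      with positive-difference b<a
    ...   | a′ , 0<a′ , refl =
      subst Linked (+-comm b a)
        (Linked-extend 0<b (m<m+n b 0<a′)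
          (go b a′ (rec (m<m+n (b + a′) 0<b)) 0<b 0<a′
              (coprime-reduce (Coprimality.sym coprime))
              (Shift-restrict (m≤n+m a′ b) shiftB) (Shift-reduce shiftB shiftA))
          shiftB)

module Graph (S : Subset) where

  Edge-sym : ∀ {x y} → Edge S x y → Edge S y x
  Edge-sym {x} {y} (0<x , 0<y , x≢y , x+y∈S) =
    0<y , 0<x , x≢y ∘ sym , subst S (+-comm x y) x+y∈S

  SameComponent-isEquivalence : IsEquivalence (SameComponent S)
  SameComponent-isEquivalence = record
    { refl = ε ; sym = reverse Edge-sym ; trans = _◅◅_ }

  open Shifts SameComponent-isEquivalence public

  sum∈S⇒SameComponent : ∀ {x y} → 0 < x → 0 < y → S (x + y) → SameComponent S x y
  sum∈S⇒SameComponent {x} {y} 0<x 0<y x+y∈S with x ≟ y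
  ... | yes refl = ε
  ... | no x≢y = (0<x , 0<y , x≢y , x+y∈S) ◅ ε

  pair∈S⇒Shift : ∀ {a d} → 0 < a → S d → S (a + d) → Shift a d
  pair∈S⇒Shift {a} {d} 0<a d∈S a+d∈S x 0<x x<d =
    sum∈S⇒SameComponent 0<x 0<d∸x (subst S (sym (m+[n∸m]≡n x≤d)) d∈S)
    ◅◅ sum∈S⇒SameComponent 0<d∸x (<-≤-trans 0<x (m≤m+n x a)) (subst S (sym sum) a+d∈S)
    where
    x≤d = <⇒≤ x<d
    0<d∸x = m<n⇒0<n∸m x<d
    sum : d ∸ x + (x + a) ≡ a + d
    sum = begin
      d ∸ x + (x + a) ≡⟨ +-assoc (d ∸ x) x a ⟨
      d ∸ x + x + a   ≡⟨ cong (_+ a) (m∸n+n≡m x≤d) ⟩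
      d + a           ≡⟨ +-comm d a ⟩
      a + d           ∎
      where open ≡-Reasoning

  Config⇒Linked : ∀ {a b c d} → Config S a b c d → Linked (a + b)
  Config⇒Linked (0<a , 0<b , _ , _ , gcd≡1 , a≤c , b≤d , d∈S , a+d∈S , c∈S , b+c∈S) =
    Coprime⇒Linked 0<a 0<b (gcd≡1⇒coprime gcd≡1)
      (Shift-restrict b≤d (pair∈S⇒Shift 0<a d∈S a+d∈S))
      (Shift-restrict a≤c (pair∈S⇒Shift 0<b c∈S b+c∈S))

  Config⇒Linked-far : ∀ {a b c d} → Config S a b c d → Linked (a + d)
  Config⇒Linked-far config@(0<a , 0<b , _ , _ , _ , _ , _ , d∈S , a+d∈S , _ , _) =
    Linked-extend 0<a (m<m+n _ 0<b) (Config⇒Linked config) (pair∈S⇒Shift 0<a d∈S a+d∈S)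

  Config-swap : ∀ {a b c d} → Config S a b c d → Config S b a d c
  Config-swap {a} {b} (0<a , 0<b , 0<c , 0<d , gcd≡1 , a≤c , b≤d , d∈S , a+d∈S , c∈S , b+c∈S) =
    0<b , 0<a , 0<d , 0<c , trans (gcd-comm b a) gcd≡1 , b≤d , a≤c , c∈S , b+c∈S , d∈S , a+d∈S

  pair⇒Config : ∀ {a b} → 0 < a → 0 < b → gcd a b ≡ 1 → S a → S b → S (a + b) →
                Config S a b a b
  pair⇒Config {a} {b} 0<a 0<b gcd≡1 a∈S b∈S a+b∈S =
    0<a , 0<b , 0<a , 0<b , gcd≡1 , ≤-refl , ≤-refl , b∈S , a+b∈S , a∈S , subst S (+-comm a b) a+b∈S

  InfinitelyManyConfigs⇒Linked : InfinitelyManyConfigs S → ∀ N → ∃ λ L → N < L × Linked L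
  InfinitelyManyConfigs⇒Linked many N with many N
  ... | a , _ , _ , d , config , inj₁ N<d =
    a + d , <-≤-trans N<d (m≤n+m d a) , Config⇒Linked-far config
  ... | a , _ , _ , d , config , inj₂ (inj₁ N<a+d) =
    a + d , N<a+d , Config⇒Linked-far config
  ... | _ , b , c , _ , config , inj₂ (inj₂ (inj₁ N<c)) =
    b + c , <-≤-trans N<c (m≤n+m c b) , Config⇒Linked-far (Config-swap config)
  ... | _ , b , c , _ , config , inj₂ (inj₂ (inj₂ N<b+c)) =
    b + c , N<b+c , Config⇒Linked-far (Config-swap config)

  InfinitelyManyConfigs⇒Connected : InfinitelyManyConfigs S → Connected S
  InfinitelyManyConfigs⇒Connected many x y 0<x 0<y with InfinitelyManyConfigs⇒Linked many (x + y)
  ... | L , x+y<L , linked =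
    Linked⇒related linked 0<x (≤-<-trans (m≤m+n x y) x+y<L) 0<y (≤-<-trans (m≤n+m y x) x+y<L)

  Avoids-not : ∀ {f} → Avoids S f → Avoids S (not ∘ f)
  Avoids-not avoids x y 0<x 0<y x≢y = avoids x y 0<x 0<y x≢y ∘ not-injective

  Avoids⇒flips : ∀ {f x y} → Avoids S f → Edge S x y → f y ≡ not (f x)
  Avoids⇒flips {f} {x} {y} avoids (0<x , 0<y , x≢y , x+y∈S) =
    ¬-not (λ fy≡fx → avoids x y 0<x 0<y x≢y (sym fy≡fx) x+y∈S)

  Avoids⇒agreement-spreads : ∀ {f g x y} → Avoids S f → Avoids S g →
                             SameComponent S x y → f x ≡ g x → f y ≡ g y
  Avoids⇒agreement-spreads _ _ ε fx≡gx = fx≡gx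
  Avoids⇒agreement-spreads {f} {g} avoidsF avoidsG (edge ◅ walk) fx≡gx =
    Avoids⇒agreement-spreads avoidsF avoidsG walk
      (trans (Avoids⇒flips avoidsF edge)
        (trans (cong not fx≡gx) (sym (Avoids⇒flips avoidsG edge))))

  Connected⇒unique-avoidance : Connected S →
                               ∀ f g → Avoids S f → Avoids S g → SamePartition f g
  Connected⇒unique-avoidance connected f g avoidsF avoidsG with f 1 Bool.≟ g 1
  ... | yes f1≡g1 = inj₁ λ x 0<x →
    Avoids⇒agreement-spreads avoidsF avoidsG (connected 1 x z<s 0<x) f1≡g1
  ... | no f1≢g1 = inj₂ λ x 0<x →
    Avoids⇒agreement-spreads avoidsF (Avoids-not avoidsG) (connected 1 x z<s 0<x) (¬-not f1≢g1)

mainTheorem6 : (S : ℕ → Set) →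
    (∀ a b c d → Config S a b c d →
      ∀ x y → 0 < x → x < a + b → 0 < y → y < a + b → SameComponent S x y)
    × (∀ a b → 0 < a → 0 < b → gcd a b ≡ 1 → S a → S b → S (a + b) →
      ∀ x y → 0 < x → x < a + b → 0 < y → y < a + b → SameComponent S x y)
    × (InfinitelyManyConfigs S → Connected S × (Avoidable S → UniquelyAvoidable S))
mainTheorem6 S = configLinked , pairLinked , connectedAndUnique
  where
  open Graph S
  configLinked : ∀ a b c d → Config S a b c d →
    ∀ x y → 0 < x → x < a + b → 0 < y → y < a + b → SameComponent S x y
  configLinked a b c d config x y = Linked⇒related (Config⇒Linked config)
  pairLinked : ∀ a b → 0 < a → 0 < b → gcd a b ≡ 1 → S a → S b → S (a + b) →
    ∀ x y → 0 < x → x < a + b → 0 < y → y < a + b → SameComponent S x y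
  pairLinked a b 0<a 0<b gcd≡1 a∈S b∈S a+b∈S =
    configLinked a b a b (pair⇒Config 0<a 0<b gcd≡1 a∈S b∈S a+b∈S)
  connectedAndUnique : InfinitelyManyConfigs S → Connected S × (Avoidable S → UniquelyAvoidable S)
  connectedAndUnique many =
    connected , λ avoidable → avoidable , Connected⇒unique-avoidance connected
    where
    connected : Connected S
    connected = InfinitelyManyConfigs⇒Connected many
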